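{- For all states $i,s$ of an LTS with inputs and outputs, $i\mathrel{\mathsf{iocos}} s$ holds if and only if for every formula $\phi\in\widetilde{\mathcal L}_{\mathsf{iocos}}$, $s\models\phi$ implies $i\models\phi$.
   Context: Fix disjoint finite sets $I$ of input actions (written $a?,b?,\dots$) and $O$ of output actions (written $a!,b!,\dots$), where $O$ contains a distinguished quiescence action $\delta!$; let $L=I\cup O$. An LTS with inputs and outputs is a tuple $(S,I,O,\to)$ with $\to\subseteq S\times L\times S$, such that $p\xrightarrow{\delta!}p'$ iff $p=p'$ and $p$ has no $a!$-transition for any $a!\in O\setminus\{\delta!\}$. LTSs are image-finite (finitely many $a$-successors of each state for each $a$). Let $\mathsf{ins}(p)=\{a?\in I\mid p \text{ has an } a?\text{ -transition}\}$. A relation $R\subseteq S\times S$ is an iocos-relation if for every $(p,q)\in R$: (1) $\mathsf{ins}(q)\subseteq\mathsf{ins}(p)$; (2) for every $a?\in\mathsf{ins}(q)$ and $p\xrightarrow{a?}p'$ there is $q\xrightarrow{a?}q'$ with $(p',q')\in R$; (3) for every $a!\in O$ and $p\xrightarrow{a!}p'$ there is $q\xrightarrow{a!}q'$ with $(p',q')\in R$. $\mathsf{iocos}$ is the union of all iocos-relations. The logic $\widetilde{\mathcal L}_{\mathsf{iocos}}$ has formulae $\phi::=\mathrm{tt}\mid\mathrm{ff}\mid\phi\wedge\phi\mid\phi\vee\phi\mid[\![a?]\!]\phi\mid[a!]\phi$ with $a?\in I$, $a!\in O$; Boolean constructs as usual, $p\models[a!]\phi$ iff $p'\models\phi$ for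 every $p'$ with $p\xrightarrow{a!}p'$, and $p\models[\![a?]\!]\phi$ iff $p$ has at least one $a?$-transition and $p'\models\phi$ for every $p'$ with $p\xrightarrow{a?}p'$. -}

module Defs where

open import Level using (Level; 0ℓ; suc)
open import Data.Nat using (ℕ)
open import Data.Fin using (Fin)
open import Data.List using (List; [])
open import Data.List.Membership.Propositional using (_∈_)
open import Data.List.Relation.Unary.All using (All)
open import Data.List.Relation.Unary.Any using (Any)
open import Data.Product using (Σ; ∃; _×_)
open import Data.Unit using (⊤)
open import Data.Empty using (⊥)
open import Data.Sum using (_⊎_)
open import Relation.Binary.PropositionalEquality using (_≡_; _≢_)
open import Relation.Nullary using (¬_)
open import Function.Bundles using (_⇔_)

-- Input actions are Fin nI (a?), output actions are Fin nO (a!); the two sets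
-- are disjoint by construction (they live in different types). δ : Fin nO is
-- the distinguished quiescence output.
record Actions : Set where
  field
    nI : ℕ
    nO : ℕ
    δ  : Fin nO

-- An image-finite LTS with inputs and outputs over the given actions.
-- Image-finiteness: the a-successors of each state are given by a finite list;
-- p --a--> p' iff p' ∈ succ p a.
record IOLTS (A : Actions) : Set₁ where
  open Actions A
  field
    State   : Set
    inSucc  : State → Fin nI → List State
    outSucc : State → Fin nO → List State
    quiescence : ∀ p p' → (p' ∈ outSucc p δ) ⇔
                 (p' ≡ p × (∀ (a : Fin nO) → a ≢ δ → outSucc p a ≡ []))

module _ {A : Actions} (M : IOLTS A) where
  open Actions A
  open IOLTS M

  _—in[_]→_ : State → Fin nI → State → Set
  p —in[ a ]→ p' = p' ∈ inSucc p a

  _—out[_]→_ : State → Fin nO → State → Set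
  p —out[ a ]→ p' = p' ∈ outSucc p a

  HasIn : State → Fin nI → Set
  HasIn p a = ∃ λ p' → p —in[ a ]→ p'

  IsIocosRel : (State → State → Set) → Set
  IsIocosRel R = ∀ p q → R p q →
      (∀ a → HasIn q a → HasIn p a)
    × (∀ a → HasIn q a → ∀ p' → p —in[ a ]→ p' →
          ∃ λ q' → q —in[ a ]→ q' × R p' q')
    × (∀ a p' → p —out[ a ]→ p' →
          ∃ λ q' → q —out[ a ]→ q' × R p' q')

  iocos : State → State → Set₁
  iocos p q = Σ (State → State → Set) λ R → IsIocosRel R × R p q

data Formula (A : Actions) : Set where
  tt ff : Formula A
  _∧_ _∨_ : Formula A → Formula A → Formula A
  ⟦_⟧_ : Fin (Actions.nI A) → Formula A → Formula A
  [_]_ : Fin (Actions.nO A) → Formula A → Formula A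

module _ {A : Actions} (M : IOLTS A) where
  open Actions A
  open IOLTS M

  sat : State → Formula A → Set
  sat p tt = ⊤
  sat p ff = ⊥
  sat p (φ ∧ ψ) = sat p φ × sat p ψ
  sat p (φ ∨ ψ) = sat p φ ⊎ sat p ψ
  sat p (⟦ a ⟧ φ) = HasIn M p a × (∀ p' → p' ∈ inSucc p a → sat p' φ)
  sat p ([ a ] φ) = ∀ p' → p' ∈ outSucc p a → sat p' φ

-- An iocos-relation transports every formula from the right state to the
-- left one, by induction on the formula.  Conversely, with excluded middle,
-- the logical preorder  p ≼ q  (every formula of q holds in p) is itself an
-- iocos-relation: the formula ⟦ a ⟧ tt recovers the input condition, and if
-- no a-successor q' of q satisfied p' ≼ q', a disjunction of formulas
-- distinguishing p' from each of the finitely many q' would hold after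
-- [ a ] (or ⟦ a ⟧) in q but fail in p'.
module Submission where

open import Defs
open import Level using (0ℓ)
open import Axiom.ExcludedMiddle using (ExcludedMiddle)
open import Axiom.DoubleNegationElimination using (em⇒dne)
open import Function.Bundles using (_⇔_; mk⇔)
open import Data.List using (List; []; _∷_)
open import Data.List.Membership.Propositional using (_∈_)
open import Data.List.Relation.Unary.Any using (here; there)
open import Data.List.Relation.Unary.All as All using (All; []; _∷_)
open import Data.Product using (∃; _×_; _,_; proj₁; proj₂)
open import Data.Sum using (inj₁; inj₂; fromInj₂)
open import Data.Unit using (tt)
open import Data.Empty using (⊥-elim)
open import Relation.Nullary using (¬_; yes; no)
open import Relation.Binary.PropositionalEquality using (refl)

module _ {A : Actions} (M : IOLTS A) where
  open IOLTS M

  _≼_ : State → State → Set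
  p ≼ q = ∀ (φ : Formula A) → sat M q φ → sat M p φ

  iocosRel⇒≼ : ∀ {R p q} → IsIocosRel M R → R p q → p ≼ q
  iocosRel⇒≼ isR r Formula.tt h = h
  iocosRel⇒≼ isR r ff ()
  iocosRel⇒≼ isR r (φ ∧ ψ) (hφ , hψ) = iocosRel⇒≼ isR r φ hφ , iocosRel⇒≼ isR r ψ hψ
  iocosRel⇒≼ isR r (φ ∨ ψ) (inj₁ h) = inj₁ (iocosRel⇒≼ isR r φ h)
  iocosRel⇒≼ isR r (φ ∨ ψ) (inj₂ h) = inj₂ (iocosRel⇒≼ isR r ψ h)
  iocosRel⇒≼ {p = p} {q = q} isR r (⟦ a ⟧ φ) (q-has-a , h) =
    proj₁ (isR p q r) a q-has-a , λ p' p→p' →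
      let q' , q→q' , r' = proj₁ (proj₂ (isR p q r)) a q-has-a p' p→p'
      in iocosRel⇒≼ isR r' φ (h q' q→q')
  iocosRel⇒≼ {p = p} {q = q} isR r ([ a ] φ) h p' p→p' =
    let q' , q→q' , r' = proj₂ (proj₂ (isR p q r)) a p' p→p'
    in iocosRel⇒≼ isR r' φ (h q' q→q')

module _ (em : ExcludedMiddle 0ℓ) {A : Actions} (M : IOLTS A) where
  open IOLTS M

  ¬≼⇒distinguishing : ∀ {p q} → ¬ (_≼_ M p q) →
                      ∃ λ φ → sat M q φ × ¬ sat M p φ
  ¬≼⇒distinguishing p⋡q = dne λ ¬∃ →
    p⋡q λ φ sat-q → dne λ ¬sat-p → ¬∃ (φ , sat-q , ¬sat-p)
    where dne = em⇒dne em

  sat-all⇒≼-some : ∀ {p} (qs : List State) →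
           (∀ ψ → All (λ q → sat M q ψ) qs → sat M p ψ) →
           ∃ λ q → q ∈ qs × _≼_ M p q
  sat-all⇒≼-some [] h = ⊥-elim (h ff [])
  sat-all⇒≼-some {p} (q ∷ qs) h with em {_≼_ M p q}
  ... | yes p≼q = q , here refl , p≼q
  ... | no p⋡q =
    let φ , sat-q , ¬sat-p = ¬≼⇒distinguishing p⋡q
        q' , q'∈qs , p≼q' = sat-all⇒≼-some qs λ ψ all-ψ →
          fromInj₂ (λ sat-p → ⊥-elim (¬sat-p sat-p))
            (h (φ ∨ ψ) (inj₁ sat-q ∷ All.map inj₂ all-ψ))
    in q' , there q'∈qs , p≼q'

  ≼-isIocosRel : IsIocosRel M (_≼_ M)
  ≼-isIocosRel p q p≼q =
      (λ a q-has-a → proj₁ (p≼q (⟦ a ⟧ Formula.tt) (q-has-a , λ _ _ → tt)))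
    , (λ a q-has-a p' p→p' → sat-all⇒≼-some (inSucc q a) λ ψ all-ψ →
         proj₂ (p≼q (⟦ a ⟧ ψ) (q-has-a , λ _ → All.lookup all-ψ)) p' p→p')
    , (λ a p' p→p' → sat-all⇒≼-some (outSucc q a) λ ψ all-ψ →
         p≼q ([ a ] ψ) (λ _ → All.lookup all-ψ) p' p→p')

theorem2 : ExcludedMiddle 0ℓ → (A : Actions) (M : IOLTS A) (i s : IOLTS.State M) →
    iocos M i s ⇔ (∀ (φ : Formula A) → sat M s φ → sat M i φ)
theorem2 em A M i s = mk⇔
  (λ (_ , isR , r) → iocosRel⇒≼ M isR r)
  (λ i≼s → _≼_ M , ≼-isIocosRel em M , i≼s)
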